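{- Let $U$ be a finite set and let $\mathbb{Y}$ be a coherent preference list on $U$ with induced choice function $f=f_{\mathbb{Y}}$. Let $X,Y$ be members of $\mathbb{Y}$ with $X\succ Y$. (i) If $f(X\cup Y)=X$, then $X$ is insensitive to every $x\in Y\setminus X$. (ii) If $X$ is insensitive to every $x\in Y\setminus X$ and there is no witness to non-substitutability $(Z,W)$ with $Z\succ X$, then $f(X\cup Y)=X$.
   Context: A preference list $\mathbb{Y}$ on $U$ is an ordered finite list of subsets of $U$ whose last element is the empty set; for members $X,Y$ we write $X\succ Y$ if $X$ properly precedes $Y$ in the list and $X\succeq Y$ if $X\succ Y$ or $X=Y$. The induced choice function $f_{\mathbb{Y}}$ maps $A\subseteq U$ to the first member of $\mathbb{Y}$ contained in $A$. $\mathbb{Y}$ is coherent if for any two members, $X\succ Y$ implies $X\not\subseteq Y$. A witness to non-substitutability is a pair $(X,Y)$ of members of $\mathbb{Y}$ with $X\succ Y$, $f(X\cup Y)=X$, and some $x\in X\setminus Y$ with $f(Y\cup\{x\})=Y$. A member $X$ of $\mathbb{Y}$ is insensitive to $x\in U$ if $f(X\cup\{x\})=X$, and sensitive to $x$ otherwise. -}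

module Defs where

open import Data.Nat using (ℕ)
open import Data.Fin using (Fin; _<_)
open import Data.Fin.Subset using (Subset; ⊥; _⊆_; _⊈_; _∪_; ⁅_⁆; _∈_; _∉_)
open import Data.Fin.Subset.Properties using (_⊆?_)
open import Data.List using (List; []; _∷_; length; lookup; last)
open import Data.Maybe using (just)
open import Data.Product using (Σ; ∃; _×_)
open import Relation.Nullary using (yes; no)
open import Relation.Binary.PropositionalEquality using (_≡_)

record PrefList (n : ℕ) : Set where
  constructor mkPrefList
  field
    elems     : List (Subset n)
    lastEmpty : last elems ≡ just ⊥
open PrefList public

_≻_within_ : {n : ℕ} → Subset n → Subset n → PrefList n → Set
X ≻ Y within 𝕐 =
  Σ (Fin (length (elems 𝕐))) λ i → Σ (Fin (length (elems 𝕐))) λ j →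
    i < j × lookup (elems 𝕐) i ≡ X × lookup (elems 𝕐) j ≡ Y

-- first member of a list contained in A (∅ if none, which never happens
-- for a preference list since its last member is ∅)
firstIn : {n : ℕ} → List (Subset n) → Subset n → Subset n
firstIn []      A = ⊥
firstIn (X ∷ L) A with X ⊆? A
... | yes _ = X
... | no  _ = firstIn L A

choice : {n : ℕ} → PrefList n → Subset n → Subset n
choice 𝕐 A = firstIn (elems 𝕐) A

Coherent : {n : ℕ} → PrefList n → Set
Coherent 𝕐 = ∀ X Y → X ≻ Y within 𝕐 → X ⊈ Y

Insensitive : {n : ℕ} → PrefList n → Subset n → Fin n → Set
Insensitive 𝕐 X x = choice 𝕐 (X ∪ ⁅ x ⁆) ≡ X

Witness : {n : ℕ} → PrefList n → Subset n → Subset n → Set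
Witness 𝕐 X Y =
  X ≻ Y within 𝕐 × choice 𝕐 (X ∪ Y) ≡ X ×
  ∃ λ x → x ∈ X × x ∉ Y × choice 𝕐 (Y ∪ ⁅ x ⁆) ≡ Y

module Submission where

-- The choice function f picks the first member of the list
-- contained in its argument, and two facts about "first member" drive
-- everything:
--   * contraction: if f(A) = X and X ⊆ B ⊆ A then f(B) = X (no earlier member
--     fits into B, since it would already fit into A);
--   * position: if the member at position i is contained in A, then f(A)
--     sits at a position ≤ i; hence f(A) = X or f(A) ≻ X for a member X ⊆ A.
-- Part (i) is contraction applied to X ⊆ X ∪ {x} ⊆ X ∪ Y.
-- Part (ii): X ⊆ X ∪ Y, so Z = f(X ∪ Y) equals X or Z ≻ X.  In the latter
-- case coherence yields z ∈ Z ∖ X, necessarily z ∈ Y; contraction gives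
-- f(Z ∪ X) = Z, and X is insensitive to z by hypothesis, so (Z , X) is a
-- witness to non-substitutability with Z ≻ X, which was excluded.

open import Defs
open import Data.Nat using (ℕ; z≤n; s≤s) renaming (_≤_ to _≤ℕ_)
open import Data.Nat.Properties using (m≤n⇒m<n∨m≡n)
open import Data.Fin using (Fin; zero; suc; toℕ)
open import Data.Fin.Properties using (toℕ-injective; ¬∀⟶∃¬)
open import Data.Fin.Subset using (Subset; _∪_; _∈_; _∉_; _⊆_; _⊈_; ⁅_⁆)
open import Data.Fin.Subset.Properties
  using (_⊆?_; _∈?_; p⊆p∪q; q⊆p∪q; x∈p∪q⁻; x∈⁅y⁆⇒x≡y; ⊥⊆)
open import Data.List using (List; []; _∷_; length; lookup)
open import Data.Product using (Σ; _×_; _,_; ∃; proj₁; proj₂)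
open import Data.Sum using (_⊎_; inj₁; inj₂)
open import Relation.Nullary using (¬_; yes; no)
open import Relation.Nullary.Decidable using (_→-dec_; decidable-stable)
open import Relation.Nullary.Negation using (contradiction)
open import Relation.Binary.PropositionalEquality using (_≡_; refl; sym; trans; cong; subst)

private
  variable
    n : ℕ

-- A failed inclusion p ⊈ q has a concrete counterexample (membership in
-- Fin n is decidable, so the classical argument goes through).
⊈⇒counterexample : (p q : Subset n) → p ⊈ q → ∃ λ x → x ∈ p × x ∉ q
⊈⇒counterexample {n} p q p⊈q
  with ¬∀⟶∃¬ n (λ x → x ∈ p → x ∈ q) (λ x → x ∈? p →-dec x ∈? q) (λ all → p⊈q (all _))
... | x , ¬[x∈p→x∈q] =
  x , decidable-stable (x ∈? p) (λ x∉p → ¬[x∈p→x∈q] (λ x∈p → contradiction x∈p x∉p))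
    , (λ x∈q → ¬[x∈p→x∈q] (λ _ → x∈q))

∪-least : {p q r : Subset n} → p ⊆ r → q ⊆ r → p ∪ q ⊆ r
∪-least {p = p} {q} p⊆r q⊆r x∈p∪q with x∈p∪q⁻ p q x∈p∪q
... | inj₁ x∈p = p⊆r x∈p
... | inj₂ x∈q = q⊆r x∈q

∈∪-not-left : (p q : Subset n) {x : Fin n} → x ∈ p ∪ q → x ∉ p → x ∈ q
∈∪-not-left p q x∈p∪q x∉p with x∈p∪q⁻ p q x∈p∪q
... | inj₁ x∈p = contradiction x∈p x∉p
... | inj₂ x∈q = x∈q

⁅x⁆⊆ : {x : Fin n} {p : Subset n} → x ∈ p → ⁅ x ⁆ ⊆ p
⁅x⁆⊆ {x = x} {p} x∈p y∈⁅x⁆ = subst (_∈ p) (sym (x∈⁅y⁆⇒x≡y x y∈⁅x⁆)) x∈p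

firstIn-⊆ : (L : List (Subset n)) (A : Subset n) → firstIn L A ⊆ A
firstIn-⊆ []      A = ⊥⊆
firstIn-⊆ (Z ∷ L) A with Z ⊆? A
... | yes Z⊆A = Z⊆A
... | no  _   = firstIn-⊆ L A

-- Contraction: a choice made from A persists on every B with X ⊆ B ⊆ A,
-- because a member fitting into B would already have fitted into A.
firstIn-contract : (L : List (Subset n)) {A B X : Subset n} →
  firstIn L A ≡ X → X ⊆ B → B ⊆ A → firstIn L B ≡ X
firstIn-contract []      chosen _ _ = chosen
firstIn-contract (Z ∷ L) {A} {B} chosen X⊆B B⊆A with Z ⊆? A | Z ⊆? B
... | yes _   | yes _   = chosen
... | yes _   | no  Z⊈B = contradiction (λ {z} z∈Z → X⊆B (subst (z ∈_) chosen z∈Z)) Z⊈B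
... | no  Z⊈A | yes Z⊆B = contradiction (λ {z} z∈Z → B⊆A (Z⊆B {z} z∈Z)) Z⊈A
... | no  _   | no  _   = firstIn-contract L chosen X⊆B B⊆A

firstIn-at-or-before : (L : List (Subset n)) (A : Subset n) (i : Fin (length L)) →
  lookup L i ⊆ A →
  Σ (Fin (length L)) λ k → toℕ k ≤ℕ toℕ i × lookup L k ≡ firstIn L A
firstIn-at-or-before (Z ∷ L) A i       fits with Z ⊆? A
... | yes _ = zero , z≤n , refl
firstIn-at-or-before (Z ∷ L) A zero    fits | no Z⊈A = contradiction (λ {x} → fits {x}) Z⊈A
firstIn-at-or-before (Z ∷ L) A (suc i) fits | no _
  with firstIn-at-or-before L A i fits
... | k , k≤i , at-k = suc k , s≤s k≤i , at-k

choice-insensitive : (𝕐 : PrefList n) {A X : Subset n} {x : Fin n} →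
  choice 𝕐 A ≡ X → X ⊆ A → x ∈ A → Insensitive 𝕐 X x
choice-insensitive 𝕐 chosen X⊆A x∈A =
  firstIn-contract (elems 𝕐) chosen (p⊆p∪q _) (∪-least X⊆A (⁅x⁆⊆ x∈A))

choice-≡-or-≻ : (𝕐 : PrefList n) {A X : Subset n} (i : Fin (length (elems 𝕐))) →
  lookup (elems 𝕐) i ≡ X → X ⊆ A →
  choice 𝕐 A ≡ X ⊎ choice 𝕐 A ≻ X within 𝕐
choice-≡-or-≻ 𝕐 {A} i at-i X⊆A
  with firstIn-at-or-before (elems 𝕐) A i (λ {x} x∈ → X⊆A (subst (x ∈_) at-i x∈))
... | k , k≤i , at-k with m≤n⇒m<n∨m≡n k≤i
...   | inj₁ k<i = inj₂ (k , i , k<i , at-k , at-i)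
...   | inj₂ k≡i =
  inj₁ (trans (sym at-k) (trans (cong (lookup (elems 𝕐)) (toℕ-injective k≡i)) at-i))

-- If the choice Z from X ∪ Y strictly precedes X, coherence provides
-- z ∈ Z ∖ X ⊆ Y; when X is insensitive to the elements of Y ∖ X, the pair
-- (Z , X) is a witness to non-substitutability.
earlier-choice-witness : (𝕐 : PrefList n) → Coherent 𝕐 → (X Y : Subset n) →
  (∀ x → x ∈ Y → x ∉ X → Insensitive 𝕐 X x) →
  choice 𝕐 (X ∪ Y) ≻ X within 𝕐 → Witness 𝕐 (choice 𝕐 (X ∪ Y)) X
earlier-choice-witness {n} 𝕐 coh X Y insensitive Z≻X =
  Z≻X , Z∪X-chooses-Z , z , z∈Z , z∉X , insensitive z z∈Y z∉X
  where
    Z : Subset n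
    Z = choice 𝕐 (X ∪ Y)
    Z⊆X∪Y : Z ⊆ X ∪ Y
    Z⊆X∪Y = firstIn-⊆ (elems 𝕐) (X ∪ Y)

    Z∪X-chooses-Z : choice 𝕐 (Z ∪ X) ≡ Z
    Z∪X-chooses-Z = firstIn-contract (elems 𝕐) refl (p⊆p∪q X) (∪-least Z⊆X∪Y (p⊆p∪q Y))

    Z∖X-element : ∃ λ z → z ∈ Z × z ∉ X
    Z∖X-element = ⊈⇒counterexample Z X (coh Z X Z≻X)

    z : Fin n
    z = proj₁ Z∖X-element
    z∈Z : z ∈ Z
    z∈Z = proj₁ (proj₂ Z∖X-element)
    z∉X : z ∉ X
    z∉X = proj₂ (proj₂ Z∖X-element)

    z∈Y : z ∈ Y
    z∈Y = ∈∪-not-left X Y (Z⊆X∪Y z∈Z) z∉X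

mainTheorem7 : (n : ℕ) (𝕐 : PrefList n) → Coherent 𝕐 →
    (X Y : Subset n) → X ≻ Y within 𝕐 →
    ((choice 𝕐 (X ∪ Y) ≡ X →
        ∀ x → x ∈ Y → x ∉ X → Insensitive 𝕐 X x)
    ×
    ((∀ x → x ∈ Y → x ∉ X → Insensitive 𝕐 X x) →
        ¬ (Σ (Subset n) λ Z → Σ (Subset n) λ W →
             Witness 𝕐 Z W × Z ≻ X within 𝕐) →
        choice 𝕐 (X ∪ Y) ≡ X))
mainTheorem7 n 𝕐 coh X Y (i , _ , _ , at-i , _) = part-i , part-ii
  where
    part-i : choice 𝕐 (X ∪ Y) ≡ X → ∀ x → x ∈ Y → x ∉ X → Insensitive 𝕐 X x
    part-i chosen x x∈Y _ = choice-insensitive 𝕐 chosen (p⊆p∪q Y) (q⊆p∪q X Y x∈Y)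

    part-ii : (∀ x → x ∈ Y → x ∉ X → Insensitive 𝕐 X x) →
      ¬ (Σ (Subset n) λ Z → Σ (Subset n) λ W → Witness 𝕐 Z W × Z ≻ X within 𝕐) →
      choice 𝕐 (X ∪ Y) ≡ X
    part-ii insensitive no-witness with choice-≡-or-≻ 𝕐 i at-i (p⊆p∪q Y)
    ... | inj₁ chosen = chosen
    ... | inj₂ Z≻X    = contradiction
      (_ , X , earlier-choice-witness 𝕐 coh X Y insensitive Z≻X , Z≻X) no-witness
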